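{- Let $G$ be an imperfect pseudo-split graph with pseudo-split partition $(C,S,I)$, let $c=|C|$ and $i=|I|$, let $M_C$ be the number of vertices of $G$ of degree exactly $c+4$, and let $M_I$ be the number of vertices of $G$ of degree exactly $c$. Let $s,k$ be nonnegative integers with $s+k\ge 1$. Then $G$ is $(s,k)$-polar if and only if either (1) $k\ge i+1$ and $s\ge c-M_C+2$, or (2) $s\ge c+1$ and $k\ge i-M_I+2$.
   Context: All graphs are finite and simple. A pseudo-split partition of a graph $G$ is a partition $(C,S,I)$ of $V_G$ such that $C$ is a clique, $I$ is an independent set, either $S=\varnothing$ or $G[S]\cong C_5$, every vertex of $C$ is adjacent to every vertex of $S$, and there are no edges between $I$ and $S$. A graph is imperfect pseudo-split if it admits such a partition with $S\neq\varnothing$ (then the partition is unique). For nonnegative integers $s,k$, an $(s,k)$-polar partition of $G$ is a partition $(A,B)$ of $V_G$ such that $G[A]$ is a complete multipartite graph with at most $s$ parts and $G[B]$ is a disjoint union of at most $k$ complete graphs; $G$ is $(s,k)$-polar if it has one. -}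

module Defs where

open import Data.Nat using (ℕ; zero; suc; _+_; _≤_)
open import Data.Bool using (Bool; true; false; if_then_else_)
open import Data.Fin using (Fin; zero; suc)
open import Data.Sum using (_⊎_; inj₁; inj₂)
open import Data.Product using (Σ; _×_; _,_; ∃)
open import Relation.Binary.PropositionalEquality using (_≡_; _≢_)
open import Relation.Nullary using (¬_)
open import Function.Bundles using (_⇔_)

record Graph : Set where
  field
    n     : ℕ
    adj   : Fin n → Fin n → Bool
    sym   : ∀ u v → adj u v ≡ adj v u
    irrefl : ∀ v → adj v v ≡ false
open Graph public

Edge : (G : Graph) → Fin (n G) → Fin (n G) → Set
Edge G u v = adj G u v ≡ true

count : ∀ {m} → (Fin m → Bool) → ℕ
count {zero}  p = 0
count {suc m} p = (if p zero then 1 else 0) + count (λ x → p (suc x))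

degree : (G : Graph) → Fin (n G) → ℕ
degree G v = count (adj G v)

numDeg : (G : Graph) → ℕ → ℕ
numDeg G d = count (λ v → degree G v Data.Nat.≡ᵇ d)
  where import Data.Nat

data Part : Set where
  C S I : Part

isC isI : Part → Bool
isC C = true
isC S = false
isC I = false
isI I = true
isI C = false
isI S = false

succ5 : Fin 5 → Fin 5
succ5 zero = suc zero
succ5 (suc zero) = suc (suc zero)
succ5 (suc (suc zero)) = suc (suc (suc zero))
succ5 (suc (suc (suc zero))) = suc (suc (suc (suc zero)))
succ5 (suc (suc (suc (suc zero)))) = zero

C5Adj : Fin 5 → Fin 5 → Set
C5Adj i j = (j ≡ succ5 i) ⊎ (i ≡ succ5 j)

InducedC5 : (G : Graph) → (Fin (n G) → Part) → Set
InducedC5 G part =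
  Σ (Fin 5 → Fin (n G)) λ f →
    (∀ i j → f i ≡ f j → i ≡ j) ×
    (∀ i → part (f i) ≡ S) ×
    (∀ v → part v ≡ S → ∃ λ i → f i ≡ v) ×
    (∀ i j → Edge G (f i) (f j) ⇔ C5Adj i j)

IsImperfectPseudoSplit : (G : Graph) → (Fin (n G) → Part) → Set
IsImperfectPseudoSplit G part =
  (∀ u v → part u ≡ C → part v ≡ C → u ≢ v → Edge G u v) ×
  (∀ u v → part u ≡ I → part v ≡ I → ¬ Edge G u v) ×
  InducedC5 G part ×
  (∀ u v → part u ≡ C → part v ≡ S → Edge G u v) ×
  (∀ u v → part u ≡ I → part v ≡ S → ¬ Edge G u v)

CompleteMultipartiteAtMost : (G : Graph) → (Fin (n G) → Bool) → ℕ → Set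
CompleteMultipartiteAtMost G inA s =
  Σ (Fin (n G) → Fin s) λ part →
    ∀ u v → inA u ≡ true → inA v ≡ true → u ≢ v →
      Edge G u v ⇔ (part u ≢ part v)

DisjointCliquesAtMost : (G : Graph) → (Fin (n G) → Bool) → ℕ → Set
DisjointCliquesAtMost G inB k =
  Σ (Fin (n G) → Fin k) λ part →
    ∀ u v → inB u ≡ true → inB v ≡ true → u ≢ v →
      Edge G u v ⇔ (part u ≡ part v)

not : Bool → Bool
not true = false
not false = true

IsPolar : Graph → ℕ → ℕ → Set
IsPolar G s k =
  Σ (Fin (n G) → Bool) λ inA →
    CompleteMultipartiteAtMost G inA s × DisjointCliquesAtMost G (λ v → not (inA v)) k

-- A 5-cycle contains both an induced P₃ and an induced co-P₃, so it lies neither in G[B] (a union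
-- of cliques) nor in G[A] (complete multipartite).  Walking around S from a vertex of A to one of B
-- shows that either (α) A contains an edge of S and B a vertex y of S, or (β) A contains a vertex x
-- of S and B two nonadjacent vertices y₁, y₂ of S.  Degrees identify M_C and M_I: a vertex v of C
-- has degree c + 4 + |N(v) ∩ I|, a vertex of S degree c + 2, and a vertex v of I degree |N(v) ∩ C|.
-- In case (α) no vertex of I lies in A (it would share a part with both ends of the edge), so I
-- together with y is independent in B and k ≥ i + 1; C ∩ A with the edge is a clique in A; and a
-- vertex v of C ∩ B with a neighbour z ∈ I would give the induced P₃ z v y in B, so C ∩ B consists of
-- vertices of degree c + 4, whence s ≥ c − M_C + 2.  Case (β) is dual: C ⊆ A, C with x is a clique
-- in A, I ∩ B with y₁, y₂ is independent in B, and every vertex of I ∩ A is complete to C.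
-- Conversely, both pairs of bounds are attained by explicit partitions of these shapes.
{-# OPTIONS --safe #-}
module Submission where

open import Defs hiding (sym)
open import Data.Nat using (ℕ; zero; suc; _+_; _≤_; _<_; _≡ᵇ_; z≤n; s≤s)
import Data.Nat.Properties as ℕ
open import Data.Fin using (Fin; zero; suc; toℕ; fromℕ<; #_)
open import Data.Fin.Properties
  using (_≟_; all?; ¬∀⟶∃¬; injective⇒≤; suc-injective; toℕ<n; toℕ-injective; fromℕ<-injective; fromℕ<-cong)
open import Data.Bool using (Bool; true; false; T; _∨_; _∧_)
import Data.Bool.Properties as Bool
open import Data.Empty using (⊥; ⊥-elim)
open import Data.Product using (∃; _×_; _,_; proj₁; proj₂; uncurry)
open import Data.Sum using (_⊎_; inj₁; inj₂; [_,_]′)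
open import Data.Unit using (tt)
open import Data.Vec using (lookup; []; _∷_)
open import Function using (_∘_; const; case_of_; _⇔_; mk⇔)
open import Function.Bundles using (module Equivalence)
import Function.Properties.Equivalence as ⇔
open import Function.Related.TypeIsomorphisms using (¬-cong-⇔)
open import Relation.Nullary using (¬_; Dec; does; yes; no)
open import Relation.Nullary.Decidable using (map′; T?; _→-dec_; _×-dec_; _⊎-dec_; ¬?; from-yes)
open import Relation.Nullary.Negation using (contradiction)
open import Relation.Binary.PropositionalEquality
  using (_≡_; _≢_; refl; sym; ≢-sym; trans; cong; cong₂; subst; subst₂; module ≡-Reasoning)

cancel-surplus : ∀ m x s → m + x + 2 ≤ s + m → x + 2 ≤ s
cancel-surplus m x s le = ℕ.+-cancelˡ-≤ m (x + 2) s
  (subst₂ _≤_ (ℕ.+-assoc m x 2) (ℕ.+-comm s m) le)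

offset-< : ∀ {o r x s} → r < x → x + o ≤ s → o + r < s
offset-< {o} {r} {x} {s} r<x x+o≤s = ℕ.≤-trans (ℕ.+-monoʳ-< o r<x) (subst (_≤ s) (ℕ.+-comm x o) x+o≤s)

surplus-+ : ∀ {a b s m} → a + 2 ≤ s → b ≤ m → a + b + 2 ≤ s + m
surplus-+ {a} {b} {s} {m} a+2≤s b≤m = subst (_≤ s + m) (a+2+b≡a+b+2) (ℕ.+-mono-≤ a+2≤s b≤m)
  where
  a+2+b≡a+b+2 : a + 2 + b ≡ a + b + 2
  a+2+b≡a+b+2 = trans (ℕ.+-assoc a 2 b) (trans (cong (a +_) (ℕ.+-comm 2 b)) (sym (ℕ.+-assoc a b 2)))

2+n≢≤1 : ∀ {m} n → m ≤ 1 → 2 + n ≢ m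
2+n≢≤1 n z≤n ()
2+n≢≤1 n (s≤s z≤n) ()

-- Finite sets as Boolean predicates, and their sizes

private variable m s : ℕ

_∪_ _∩_ : (Fin m → Bool) → (Fin m → Bool) → Fin m → Bool
(p ∪ q) v = p v ∨ q v
(p ∩ q) v = p v ∧ q v

∁ : (Fin m → Bool) → Fin m → Bool
∁ p v = not (p v)

⁅_⁆ : Fin m → Fin m → Bool
⁅ x ⁆ v = does (v ≟ x)

_⊆_ : (Fin m → Bool) → (Fin m → Bool) → Set
p ⊆ q = ∀ v → T (p v) → T (q v)

Disjoint : (Fin m → Bool) → (Fin m → Bool) → Set
Disjoint p q = ∀ v → T (p v) → T (q v) → ⊥

T-dichotomy : ∀ b → T b ⊎ T (not b)
T-dichotomy true  = inj₁ tt
T-dichotomy false = inj₂ tt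

T-¬not : ∀ {x} → ¬ T (not x) → T x
T-¬not {true} _ = tt
T-¬not {false} ¬tt = ¬tt tt

∈∪ˡ : (p q : Fin m → Bool) {v : Fin m} → T (p v) → T ((p ∪ q) v)
∈∪ˡ p q v∈p = Equivalence.from Bool.T-∨ (inj₁ v∈p)

∈∪ʳ : (p q : Fin m → Bool) {v : Fin m} → T (q v) → T ((p ∪ q) v)
∈∪ʳ p q v∈q = Equivalence.from Bool.T-∨ (inj₂ v∈q)

∈∪⁻ : (p q : Fin m → Bool) {v : Fin m} → T ((p ∪ q) v) → T (p v) ⊎ T (q v)
∈∪⁻ p q = Equivalence.to Bool.T-∨

∈∩ : (p q : Fin m → Bool) {v : Fin m} → T (p v) → T (q v) → T ((p ∩ q) v)
∈∩ p q v∈p v∈q = Equivalence.from Bool.T-∧ (v∈p , v∈q)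

∈∩⁻ : (p q : Fin m → Bool) {v : Fin m} → T ((p ∩ q) v) → T (p v) × T (q v)
∈∩⁻ p q = Equivalence.to Bool.T-∧

∈∁ : (p : Fin m → Bool) {v : Fin m} → ¬ T (p v) → T (∁ p v)
∈∁ p {v} v∉p with p v
... | true  = v∉p tt
... | false = tt

∈⁅⁆⇒≡ : (x v : Fin m) → T (⁅ x ⁆ v) → v ≡ x
∈⁅⁆⇒≡ x v v∈x with v ≟ x
... | yes v≡x = v≡x

∈∁⁅⁆⇒≢ : (x v : Fin m) → T (∁ ⁅ x ⁆ v) → v ≢ x
∈∁⁅⁆⇒≢ x v v∉x with v ≟ x
... | no v≢x = v≢x

x∈⁅x⁆ : (x : Fin m) → T (⁅ x ⁆ x)
x∈⁅x⁆ x with x ≟ x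
... | yes _ = tt
... | no x≢x = x≢x refl

⁅⁆-all : {P : Fin m → Set} (x : Fin m) → P x → ∀ v → T (⁅ x ⁆ v) → P v
⁅⁆-all {P = P} x Px v v∈x = subst P (sym (∈⁅⁆⇒≡ x v v∈x)) Px

⁅⁆∪⁅⁆-all : {P : Fin m → Set} (x y : Fin m) → P x → P y → ∀ v → T ((⁅ x ⁆ ∪ ⁅ y ⁆) v) → P v
⁅⁆∪⁅⁆-all x y Px Py v v∈ = [ ⁅⁆-all x Px v , ⁅⁆-all y Py v ]′ (∈∪⁻ ⁅ x ⁆ ⁅ y ⁆ {v} v∈)

count-mono : (p q : Fin m → Bool) → p ⊆ q → count p ≤ count q
count-mono {zero}  p q p⊆q = z≤n
count-mono {suc m} p q p⊆q with p zero | q zero | p⊆q zero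
... | true  | true  | _ = s≤s (count-mono (p ∘ suc) (q ∘ suc) (p⊆q ∘ suc))
... | true  | false | p⊆q₀ = ⊥-elim (p⊆q₀ tt)
... | false | true  | _ = ℕ.m≤n⇒m≤1+n (count-mono (p ∘ suc) (q ∘ suc) (p⊆q ∘ suc))
... | false | false | _ = count-mono (p ∘ suc) (q ∘ suc) (p⊆q ∘ suc)

count-≐ : (p q : Fin m → Bool) → p ⊆ q → q ⊆ p → count p ≡ count q
count-≐ p q p⊆q q⊆p = ℕ.≤-antisym (count-mono p q p⊆q) (count-mono q p q⊆p)

count-empty : (p : Fin m → Bool) → (∀ v → ¬ T (p v)) → count p ≡ 0
count-empty {zero}  p p∅ = refl
count-empty {suc m} p p∅ with p zero | p∅ zero
... | true  | p₀∉ = ⊥-elim (p₀∉ tt)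
... | false | _   = count-empty (p ∘ suc) (p∅ ∘ suc)

count-⁅⁆ : (x : Fin m) → count ⁅ x ⁆ ≡ 1
count-⁅⁆ {suc m} zero = cong suc (count-empty {m} (λ v → does (suc v ≟ zero)) λ v ())
count-⁅⁆ {suc m} (suc x) = count-⁅⁆ {m} x

count≡0⇒∉ : (p : Fin m → Bool) {v : Fin m} → count p ≡ 0 → ¬ T (p v)
count≡0⇒∉ p {v} count≡0 v∈p =
  ℕ.<⇒≢ (subst (_≤ count p) (count-⁅⁆ v) (count-mono ⁅ v ⁆ p v⊆p)) (sym count≡0)
  where
  v⊆p : ⁅ v ⁆ ⊆ p
  v⊆p u u∈v rewrite ∈⁅⁆⇒≡ v u u∈v = v∈p

count-∪ : (p q : Fin m → Bool) → Disjoint p q → count (p ∪ q) ≡ count p + count q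
count-∪ {zero}  p q p∩q∅ = refl
count-∪ {suc m} p q p∩q∅ with p zero | q zero | p∩q∅ zero
... | true  | true  | p∩q₀∅ = ⊥-elim (p∩q₀∅ tt tt)
... | true  | false | _ = cong suc (count-∪ (p ∘ suc) (q ∘ suc) (p∩q∅ ∘ suc))
... | false | true  | _ = trans (cong suc (count-∪ (p ∘ suc) (q ∘ suc) (p∩q∅ ∘ suc)))
                                (sym (ℕ.+-suc (count (p ∘ suc)) (count (q ∘ suc))))
... | false | false | _ = count-∪ (p ∘ suc) (q ∘ suc) (p∩q∅ ∘ suc)

count-pair : {x y : Fin m} → x ≢ y → count (⁅ x ⁆ ∪ ⁅ y ⁆) ≡ 2
count-pair {x = x} {y} x≢y = trans (count-∪ ⁅ x ⁆ ⁅ y ⁆ x∩y∅) (cong₂ _+_ (count-⁅⁆ x) (count-⁅⁆ y))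
  where
  x∩y∅ : Disjoint ⁅ x ⁆ ⁅ y ⁆
  x∩y∅ v v∈x v∈y = x≢y (trans (sym (∈⁅⁆⇒≡ x v v∈x)) (∈⁅⁆⇒≡ y v v∈y))

count-∪⁅⁆ : (p : Fin m → Bool) {x : Fin m} → ¬ T (p x) → count (p ∪ ⁅ x ⁆) ≡ count p + 1
count-∪⁅⁆ p {x} x∉p = trans (count-∪ p ⁅ x ⁆ p∩x∅) (cong (count p +_) (count-⁅⁆ x))
  where
  p∩x∅ : Disjoint p ⁅ x ⁆
  p∩x∅ v v∈p v∈x = x∉p (subst (T ∘ p) (∈⁅⁆⇒≡ x v v∈x) v∈p)

count-∪⁅⁆∪⁅⁆ : (p : Fin m → Bool) {x y : Fin m} → ¬ T (p x) → ¬ T (p y) → x ≢ y →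
  count (p ∪ (⁅ x ⁆ ∪ ⁅ y ⁆)) ≡ count p + 2
count-∪⁅⁆∪⁅⁆ p {x} {y} x∉p y∉p x≢y =
  trans (count-∪ p (⁅ x ⁆ ∪ ⁅ y ⁆) p∩xy∅) (cong (count p +_) (count-pair x≢y))
  where
  p∩xy∅ : Disjoint p (⁅ x ⁆ ∪ ⁅ y ⁆)
  p∩xy∅ v v∈p v∈xy = ⁅⁆∪⁅⁆-all {P = λ v → ¬ T (p v)} x y x∉p y∉p v v∈xy v∈p

count-split : (p q : Fin m → Bool) → count p ≡ count (p ∩ q) + count (p ∩ ∁ q)
count-split {zero}  p q = refl
count-split {suc m} p q with p zero | q zero
... | true  | true  = cong suc (count-split (p ∘ suc) (q ∘ suc))
... | true  | false = trans (cong suc (count-split (p ∘ suc) (q ∘ suc)))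
                            (sym (ℕ.+-suc (count ((p ∩ q) ∘ suc)) (count ((p ∩ ∁ q) ∘ suc))))
... | false | _     = count-split (p ∘ suc) (q ∘ suc)

count-split-⊆ : (p q : Fin m → Bool) → q ⊆ p → count p ≡ count q + count (p ∩ ∁ q)
count-split-⊆ p q q⊆p = trans (count-split p q) (cong (_+ count (p ∩ ∁ q)) (count-≐ (p ∩ q) q
  (λ v → proj₂ ∘ ∈∩⁻ p q) (λ v v∈q → ∈∩ p q (q⊆p v v∈q) v∈q)))

count-remove : (p : Fin m → Bool) {x : Fin m} → T (p x) → count p ≡ suc (count (p ∩ ∁ ⁅ x ⁆))
count-remove p {x} x∈p = trans (count-split p ⁅ x ⁆)
  (cong (_+ count (p ∩ ∁ ⁅ x ⁆)) (trans (count-≐ (p ∩ ⁅ x ⁆) ⁅ x ⁆ p∩x⊆x x⊆p∩x) (count-⁅⁆ x)))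
  where
  p∩x⊆x : (p ∩ ⁅ x ⁆) ⊆ ⁅ x ⁆
  p∩x⊆x v = proj₂ ∘ ∈∩⁻ p ⁅ x ⁆ {v}
  x⊆p∩x : ⁅ x ⁆ ⊆ (p ∩ ⁅ x ⁆)
  x⊆p∩x = ⁅⁆-all {P = T ∘ (p ∩ ⁅ x ⁆)} x (∈∩ p ⁅ x ⁆ x∈p (x∈⁅x⁆ x))

count-< : (p q : Fin m → Bool) {x : Fin m} → p ⊆ q → T (q x) → ¬ T (p x) → count p < count q
count-< p q {x} p⊆q x∈q x∉p = subst (count p <_) (sym (count-remove q x∈q))
  (s≤s (count-mono p (q ∩ ∁ ⁅ x ⁆) p⊆q∖x))
  where
  p⊆q∖x : p ⊆ (q ∩ ∁ ⁅ x ⁆)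
  p⊆q∖x v v∈p = ∈∩ q (∁ ⁅ x ⁆) (p⊆q v v∈p)
    (∈∁ ⁅ x ⁆ {v} λ v∈x → x∉p (subst (T ∘ p) (∈⁅⁆⇒≡ x v v∈x) v∈p))

position : (p : Fin m → Bool) (v : Fin m) → T (p v) → Fin (count p)
position p zero v∈p with p zero
... | true = zero
position p (suc v) v∈p with p zero
... | true  = suc (position (p ∘ suc) v v∈p)
... | false = position (p ∘ suc) v v∈p

position-injective : (p : Fin m → Bool) {u v : Fin m} (u∈p : T (p u)) (v∈p : T (p v)) →
  position p u u∈p ≡ position p v v∈p → u ≡ v
position-injective p {zero}  {zero}  _ _ _ = refl
position-injective p {zero}  {suc v} u∈p v∈p eq with p zero
position-injective p {zero}  {suc v} u∈p v∈p () | true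
position-injective p {suc u} {zero}  u∈p v∈p eq with p zero
position-injective p {suc u} {zero}  u∈p v∈p () | true
position-injective p {suc u} {suc v} u∈p v∈p eq with p zero
... | true  = cong suc (position-injective (p ∘ suc) u∈p v∈p (suc-injective eq))
... | false = cong suc (position-injective (p ∘ suc) u∈p v∈p eq)

rank : (p : Fin m → Bool) (v : Fin m) → T (p v) → ℕ
rank p v v∈p = toℕ (position p v v∈p)

rank<count : (p : Fin m → Bool) (v : Fin m) (v∈p : T (p v)) → rank p v v∈p < count p
rank<count p v v∈p = toℕ<n (position p v v∈p)

rank-injective : (p : Fin m → Bool) {u v : Fin m} (u∈p : T (p u)) (v∈p : T (p v)) →
  rank p u u∈p ≡ rank p v v∈p → u ≡ v
rank-injective p u∈p v∈p = position-injective p u∈p v∈p ∘ toℕ-injective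

enumerate : (p : Fin m → Bool) → Fin (count p) → Fin m
enumerate {suc m} p i with p zero
enumerate {suc m} p zero    | true = zero
enumerate {suc m} p (suc i) | true = suc (enumerate (p ∘ suc) i)
enumerate {suc m} p i       | false = suc (enumerate (p ∘ suc) i)

enumerate-∈ : (p : Fin m → Bool) (i : Fin (count p)) → T (p (enumerate p i))
enumerate-∈ {suc m} p i with p zero in p₀
enumerate-∈ {suc m} p zero    | true = subst T (sym p₀) tt
enumerate-∈ {suc m} p (suc i) | true = enumerate-∈ (p ∘ suc) i
enumerate-∈ {suc m} p i       | false = enumerate-∈ (p ∘ suc) i

enumerate-injective : (p : Fin m → Bool) {i j : Fin (count p)} → enumerate p i ≡ enumerate p j → i ≡ j
enumerate-injective {suc m} p {i} {j} eq with p zero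
enumerate-injective {suc m} p {zero}  {zero}  eq | true = refl
enumerate-injective {suc m} p {suc i} {suc j} eq | true =
  cong suc (enumerate-injective (p ∘ suc) (suc-injective eq))
enumerate-injective {suc m} p {i}     {j}     eq | false = enumerate-injective (p ∘ suc) (suc-injective eq)

count-≤-injection : (p : Fin m → Bool) (g : Fin m → Fin s) →
  (∀ u v → T (p u) → T (p v) → g u ≡ g v → u ≡ v) → count p ≤ s
count-≤-injection p g g-inj = injective⇒≤ λ {i} {j} eq →
  enumerate-injective p (g-inj _ _ (enumerate-∈ p i) (enumerate-∈ p j) eq)

count-image : ∀ {k} (p : Fin m → Bool) (f : Fin k → Fin m) → (∀ i j → f i ≡ f j → i ≡ j) →
  (∀ i → T (p (f i))) → (∀ v → T (p v) → ∃ λ i → f i ≡ v) → count p ≡ k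
count-image {k = k} p f f-inj f∈p onto = ℕ.≤-antisym
  (injective⇒≤ λ {i} {j} eq → enumerate-injective p
    (trans (sym (preimage-section i)) (trans (cong f eq) (preimage-section j))))
  (injective⇒≤ λ {i} {j} eq → f-inj i j (position-injective p (f∈p i) (f∈p j) eq))
  where
  preimage : Fin (count p) → Fin k
  preimage i = proj₁ (onto (enumerate p i) (enumerate-∈ p i))
  preimage-section : ∀ i → f (preimage i) ≡ enumerate p i
  preimage-section i = proj₂ (onto (enumerate p i) (enumerate-∈ p i))

-- The 5-cycle

pred5 : Fin 5 → Fin 5
pred5 zero = suc (suc (suc (suc zero)))
pred5 (suc zero) = zero
pred5 (suc (suc zero)) = suc zero
pred5 (suc (suc (suc zero))) = suc (suc zero)
pred5 (suc (suc (suc (suc zero)))) = suc (suc (suc zero))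

C5Adj? : ∀ i j → Dec (C5Adj i j)
C5Adj? i j = (j ≟ succ5 i) ⊎-dec (i ≟ succ5 j)

succ5-pred5 : ∀ j → succ5 (pred5 j) ≡ j
succ5-pred5 = from-yes (all? λ j → succ5 (pred5 j) ≟ j)

pred5-succ5 : ∀ j → pred5 (succ5 j) ≡ j
pred5-succ5 = from-yes (all? λ j → pred5 (succ5 j) ≟ j)

succ5≢pred5 : ∀ j → succ5 j ≢ pred5 j
succ5≢pred5 = from-yes (all? λ j → ¬? (succ5 j ≟ pred5 j))

succ5-pred5-nonadjacent : ∀ j → ¬ C5Adj (succ5 j) (pred5 j)
succ5-pred5-nonadjacent = from-yes (all? λ j → ¬? (C5Adj? (succ5 j) (pred5 j)))

C5Adj-succ5 : ∀ j → C5Adj j (succ5 j)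
C5Adj-succ5 j = inj₁ refl

C5Adj-pred5 : ∀ j → C5Adj (pred5 j) j
C5Adj-pred5 j = inj₁ (sym (succ5-pred5 j))

C5Adj⇔neighbour : ∀ {i j} → C5Adj i j ⇔ (j ≡ succ5 i ⊎ j ≡ pred5 i)
C5Adj⇔neighbour {i} {j} = mk⇔ to from
  where
  to : C5Adj i j → j ≡ succ5 i ⊎ j ≡ pred5 i
  to (inj₁ j≡i⁺) = inj₁ j≡i⁺
  to (inj₂ refl) = inj₂ (sym (pred5-succ5 j))
  from : j ≡ succ5 i ⊎ j ≡ pred5 i → C5Adj i j
  from (inj₁ j≡i⁺) = inj₁ j≡i⁺
  from (inj₂ refl) = inj₂ (sym (succ5-pred5 i))

module _ (σ : Fin 5 → Bool) (closed : ∀ j → T (σ j) → T (σ (succ5 j))) where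

  private
    σ-zero : ∀ j → T (σ j) → T (σ zero)
    σ-zero zero σj = σj
    σ-zero (suc zero) σj = closed _ (closed _ (closed _ (closed _ σj)))
    σ-zero (suc (suc zero)) σj = closed _ (closed _ (closed _ σj))
    σ-zero (suc (suc (suc zero))) σj = closed _ (closed _ σj)
    σ-zero (suc (suc (suc (suc zero)))) σj = closed _ σj

    zero-σ : ∀ j → T (σ zero) → T (σ j)
    zero-σ zero σ₀ = σ₀
    zero-σ (suc zero) σ₀ = closed _ σ₀
    zero-σ (suc (suc zero)) σ₀ = closed _ (closed _ σ₀)
    zero-σ (suc (suc (suc zero))) σ₀ = closed _ (closed _ (closed _ σ₀))
    zero-σ (suc (suc (suc (suc zero)))) σ₀ = closed _ (closed _ (closed _ (closed _ σ₀)))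

  succ5-closed⇒constant : ∀ i j → T (σ i) → T (σ j)
  succ5-closed⇒constant i j = zero-σ j ∘ σ-zero i

c5-two-colouring : (σ : Fin 5 → Bool) →
  (∀ j → T (σ j)) ⊎ (∀ j → T (not (σ j))) ⊎ (∃ λ j → T (σ j) × T (not (σ (succ5 j))))
c5-two-colouring σ with all? (T? ∘ σ) | all? (T? ∘ not ∘ σ)
... | yes all-in | _ = inj₁ all-in
... | no _ | yes all-out = inj₂ (inj₁ all-out)
... | no ¬all-in | no ¬all-out with ¬∀⟶∃¬ 5 _ (T? ∘ σ) ¬all-in | ¬∀⟶∃¬ 5 _ (T? ∘ not ∘ σ) ¬all-out
... | b , b-out | a , ¬a-out with ¬∀⟶∃¬ 5 (λ j → T (σ j) → T (σ (succ5 j))) (λ j → T? _ →-dec T? _)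
                                   (λ closed → b-out (succ5-closed⇒constant σ closed a b (T-¬not ¬a-out)))
... | j , ¬step = inj₂ (inj₂ (j , boundary ¬step))
  where
  boundary : ∀ {x y} → ¬ (T x → T y) → T x × T (not y)
  boundary {true} {false} _ = tt , tt
  boundary {true} {true} ¬step = ⊥-elim (¬step λ _ → tt)
  boundary {false} ¬step = ⊥-elim (¬step λ ())

_⇔?_ : ∀ {P Q : Set} → Dec P → Dec Q → Dec (P ⇔ Q)
P? ⇔? Q? = map′ (uncurry mk⇔) (λ P⇔Q → Equivalence.to P⇔Q , Equivalence.from P⇔Q)
                ((P? →-dec Q?) ×-dec (Q? →-dec P?))

PartsOnC5 CliquesOnC5 : (Fin 5 → Bool) → (Fin 5 → ℕ) → Set
PartsOnC5 σ ℓ = ∀ i j → T (σ i) → T (σ j) → i ≢ j → C5Adj i j ⇔ (ℓ i ≢ ℓ j)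
CliquesOnC5 σ ℓ = ∀ i j → T (σ i) → T (σ j) → i ≢ j → C5Adj i j ⇔ (ℓ i ≡ ℓ j)

partsOnC5? : ∀ σ ℓ → Dec (PartsOnC5 σ ℓ)
partsOnC5? σ ℓ = all? λ i → all? λ j → T? (σ i) →-dec T? (σ j) →-dec ¬? (i ≟ j) →-dec
  (C5Adj? i j ⇔? ¬? (ℓ i ℕ.≟ ℓ j))

cliquesOnC5? : ∀ σ ℓ → Dec (CliquesOnC5 σ ℓ)
cliquesOnC5? σ ℓ = all? λ i → all? λ j → T? (σ i) →-dec T? (σ j) →-dec ¬? (i ≟ j) →-dec
  (C5Adj? i j ⇔? (ℓ i ℕ.≟ ℓ j))

-- Cliques, independent sets and polar partitions

module _ (G : Graph) where

  private
    V = Fin (n G)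
    variable u v w x y : V

  edge-sym : Edge G u v → Edge G v u
  edge-sym {u} {v} uv = trans (Graph.sym G v u) uv

  edge⇒≢ : Edge G u v → u ≢ v
  edge⇒≢ {u} uu refl with trans (sym (irrefl G u)) uu
  ... | ()

  edge? : ∀ u v → Dec (Edge G u v)
  edge? u v = adj G u v Bool.≟ true

  IsClique IsIndependent : (V → Bool) → Set
  IsClique p = ∀ u v → T (p u) → T (p v) → u ≢ v → Edge G u v
  IsIndependent p = ∀ u v → T (p u) → T (p v) → ¬ Edge G u v

  ⁅⁆-clique : ∀ x → IsClique ⁅ x ⁆
  ⁅⁆-clique x u v u∈x v∈x u≢v = contradiction (trans (∈⁅⁆⇒≡ x u u∈x) (sym (∈⁅⁆⇒≡ x v v∈x))) u≢v

  ⁅⁆-independent : ∀ x → IsIndependent ⁅ x ⁆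
  ⁅⁆-independent x u v u∈x v∈x uv = edge⇒≢ uv (trans (∈⁅⁆⇒≡ x u u∈x) (sym (∈⁅⁆⇒≡ x v v∈x)))

  clique-∪ : ∀ {p q} → IsClique p → IsClique q → (∀ u v → T (p u) → T (q v) → Edge G u v) →
    IsClique (p ∪ q)
  clique-∪ {p} {q} p-clique q-clique p–q u v u∈ v∈ u≢v
    with ∈∪⁻ p q u∈ | ∈∪⁻ p q v∈
  ... | inj₁ u∈p | inj₁ v∈p = p-clique u v u∈p v∈p u≢v
  ... | inj₁ u∈p | inj₂ v∈q = p–q u v u∈p v∈q
  ... | inj₂ u∈q | inj₁ v∈p = edge-sym (p–q v u v∈p u∈q)
  ... | inj₂ u∈q | inj₂ v∈q = q-clique u v u∈q v∈q u≢v

  independent-∪ : ∀ {p q} → IsIndependent p → IsIndependent q →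
    (∀ u v → T (p u) → T (q v) → ¬ Edge G u v) → IsIndependent (p ∪ q)
  independent-∪ {p} {q} p-indep q-indep p–q u v u∈ v∈
    with ∈∪⁻ p q u∈ | ∈∪⁻ p q v∈
  ... | inj₁ u∈p | inj₁ v∈p = p-indep u v u∈p v∈p
  ... | inj₁ u∈p | inj₂ v∈q = p–q u v u∈p v∈q
  ... | inj₂ u∈q | inj₁ v∈p = p–q v u v∈p u∈q ∘ edge-sym
  ... | inj₂ u∈q | inj₂ v∈q = q-indep u v u∈q v∈q

  edge-clique : Edge G x y → IsClique (⁅ x ⁆ ∪ ⁅ y ⁆)
  edge-clique {x} {y} xy = clique-∪ (⁅⁆-clique x) (⁅⁆-clique y) x–y
    where
    x–y : ∀ u v → T (⁅ x ⁆ u) → T (⁅ y ⁆ v) → Edge G u v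
    x–y u v u∈x v∈y with ∈⁅⁆⇒≡ x u u∈x | ∈⁅⁆⇒≡ y v v∈y
    ... | refl | refl = xy

  nonEdge-independent : ¬ Edge G x y → IsIndependent (⁅ x ⁆ ∪ ⁅ y ⁆)
  nonEdge-independent {x} {y} ¬xy = independent-∪ (⁅⁆-independent x) (⁅⁆-independent y) x≁y
    where
    x≁y : ∀ u v → T (⁅ x ⁆ u) → T (⁅ y ⁆ v) → ¬ Edge G u v
    x≁y u v u∈x v∈y with ∈⁅⁆⇒≡ x u u∈x | ∈⁅⁆⇒≡ y v v∈y
    ... | refl | refl = ¬xy

  edge⇔ : ∀ {P : Set} → Edge G u v → P → Edge G u v ⇔ P
  edge⇔ uv p = mk⇔ (const p) (const uv)

  nonEdge⇔ : ∀ {P : Set} → ¬ Edge G u v → ¬ P → Edge G u v ⇔ P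
  nonEdge⇔ ¬uv ¬p = mk⇔ (⊥-elim ∘ ¬uv) (⊥-elim ∘ ¬p)

  clique-⊆ : ∀ {p q} → q ⊆ p → IsClique p → IsClique q
  clique-⊆ q⊆p p-clique u v u∈q v∈q = p-clique u v (q⊆p u u∈q) (q⊆p v v∈q)

  independent-⊆ : ∀ {p q} → q ⊆ p → IsIndependent p → IsIndependent q
  independent-⊆ q⊆p p-indep u v u∈q v∈q = p-indep u v (q⊆p u u∈q) (q⊆p v v∈q)

module PolarPartition (G : Graph) {s k : ℕ} (inA : Fin (n G) → Bool)
    (multipartite : CompleteMultipartiteAtMost G inA s)
    (cliques : DisjointCliquesAtMost G (λ v → not (inA v)) k) where

  private
    V = Fin (n G)
    variable u v w : V

  InA InB : V → Set
  InA v = T (inA v)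
  InB v = T (not (inA v))

  A-or-B : ∀ v → InA v ⊎ InB v
  A-or-B v = T-dichotomy (inA v)

  partA : V → Fin s
  partA = proj₁ multipartite

  cliqueB : V → Fin k
  cliqueB = proj₁ cliques

  edge⇔differentPart : InA u → InA v → u ≢ v → Edge G u v ⇔ (partA u ≢ partA v)
  edge⇔differentPart u∈A v∈A = proj₂ multipartite _ _ (Equivalence.to Bool.T-≡ u∈A) (Equivalence.to Bool.T-≡ v∈A)

  edge⇔sameClique : InB u → InB v → u ≢ v → Edge G u v ⇔ (cliqueB u ≡ cliqueB v)
  edge⇔sameClique u∈B v∈B = proj₂ cliques _ _ (Equivalence.to Bool.T-≡ u∈B) (Equivalence.to Bool.T-≡ v∈B)

  nonEdge⇒samePart : InA u → InA v → u ≢ v → ¬ Edge G u v → partA u ≡ partA v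
  nonEdge⇒samePart {u} {v} u∈A v∈A u≢v ¬uv with partA u ≟ partA v
  ... | yes same = same
  ... | no different = contradiction (Equivalence.from (edge⇔differentPart u∈A v∈A u≢v) different) ¬uv

  no-induced-P₃-in-B : InB u → InB v → InB w → u ≢ w →
    Edge G u v → Edge G v w → ¬ Edge G u w → ⊥
  no-induced-P₃-in-B u∈B v∈B w∈B u≢w uv vw ¬uw = ¬uw (Equivalence.from (edge⇔sameClique u∈B w∈B u≢w)
    (trans (Equivalence.to (edge⇔sameClique u∈B v∈B (edge⇒≢ G uv)) uv)
           (Equivalence.to (edge⇔sameClique v∈B w∈B (edge⇒≢ G vw)) vw)))

  no-induced-co-P₃-in-A : InA u → InA v → InA w → u ≢ v → v ≢ w →
    ¬ Edge G u v → ¬ Edge G v w → Edge G u w → ⊥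
  no-induced-co-P₃-in-A u∈A v∈A w∈A u≢v v≢w ¬uv ¬vw uw =
    Equivalence.to (edge⇔differentPart u∈A w∈A (edge⇒≢ G uw)) uw
      (trans (nonEdge⇒samePart u∈A v∈A u≢v ¬uv) (nonEdge⇒samePart v∈A w∈A v≢w ¬vw))

  clique-in-A-≤ : (q : V → Bool) → (∀ v → T (q v) → InA v) → IsClique G q → count q ≤ s
  clique-in-A-≤ q q⊆A q-clique = count-≤-injection q partA distinct-parts
    where
    distinct-parts : ∀ u v → T (q u) → T (q v) → partA u ≡ partA v → u ≡ v
    distinct-parts u v u∈q v∈q same with u ≟ v
    ... | yes u≡v = u≡v
    ... | no u≢v = contradiction same
      (Equivalence.to (edge⇔differentPart (q⊆A u u∈q) (q⊆A v v∈q) u≢v) (q-clique u v u∈q v∈q u≢v))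

  independent-in-B-≤ : (q : V → Bool) → (∀ v → T (q v) → InB v) → IsIndependent G q → count q ≤ k
  independent-in-B-≤ q q⊆B q-indep = count-≤-injection q cliqueB distinct-cliques
    where
    distinct-cliques : ∀ u v → T (q u) → T (q v) → cliqueB u ≡ cliqueB v → u ≡ v
    distinct-cliques u v u∈q v∈q same with u ≟ v
    ... | yes u≡v = u≡v
    ... | no u≢v = contradiction (Equivalence.from (edge⇔sameClique (q⊆B u u∈q) (q⊆B v v∈q) u≢v) same)
      (q-indep u v u∈q v∈q)

module _ (G : Graph) {A B : Fin (n G) → Set} (side : ∀ v → A v ⊎ B v)
         (L : ∀ {v} → A v → ℕ) (K : ∀ {v} → B v → ℕ) where

  -- A vertex gets label 0 on the side it does not belong to, hence 0 < s and 0 < k.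
  polar-from-sides : ∀ {s k} → 0 < s → 0 < k →
    (∀ {v} (a : A v) → L a < s) → (∀ {v} (b : B v) → K b < k) →
    (∀ {u v} (a : A u) (b : A v) → u ≢ v → Edge G u v ⇔ (L a ≢ L b)) →
    (∀ {u v} (a : B u) (b : B v) → u ≢ v → Edge G u v ⇔ (K a ≡ K b)) →
    IsPolar G s k
  polar-from-sides {s} {k} 0<s 0<k L<s K<k parts cliques =
    inA , (partA , multipartite) , (cliqueB , disjoint-cliques)
    where
    inA : Fin (n G) → Bool
    inA v = [ const true , const false ]′ (side v)
    partA : Fin (n G) → Fin s
    partA v = [ (λ a → fromℕ< (L<s a)) , const (fromℕ< 0<s) ]′ (side v)
    cliqueB : Fin (n G) → Fin k
    cliqueB v = [ const (fromℕ< 0<k) , (λ b → fromℕ< (K<k b)) ]′ (side v)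

    fromℕ<-≡⇔ : ∀ {o x y} .(x<o : x < o) .(y<o : y < o) → (x ≡ y) ⇔ (fromℕ< x<o ≡ fromℕ< y<o)
    fromℕ<-≡⇔ x<o y<o = mk⇔ (λ x≡y → fromℕ<-cong _ _ x≡y x<o y<o) (fromℕ<-injective _ _ x<o y<o)

    multipartite : ∀ u v → inA u ≡ true → inA v ≡ true → u ≢ v → Edge G u v ⇔ (partA u ≢ partA v)
    multipartite u v u∈A v∈A u≢v with side u | side v
    ... | inj₁ a | inj₁ b = ⇔.trans (parts a b u≢v) (¬-cong-⇔ (fromℕ<-≡⇔ (L<s a) (L<s b)))

    disjoint-cliques : ∀ u v → not (inA u) ≡ true → not (inA v) ≡ true → u ≢ v →
      Edge G u v ⇔ (cliqueB u ≡ cliqueB v)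
    disjoint-cliques u v u∈B v∈B u≢v with side u | side v
    ... | inj₂ a | inj₂ b = ⇔.trans (cliques a b u≢v) (fromℕ<-≡⇔ (K<k a) (K<k b))

-- Imperfect pseudo-split graphs

isS : Part → Bool
isS C = false
isS S = true
isS I = false

T-isC : ∀ {x} → T (isC x) ⇔ x ≡ C
T-isC {C} = mk⇔ (const refl) (const tt)
T-isC {S} = mk⇔ (λ ()) (λ ())
T-isC {I} = mk⇔ (λ ()) (λ ())

T-isS : ∀ {x} → T (isS x) ⇔ x ≡ S
T-isS {C} = mk⇔ (λ ()) (λ ())
T-isS {S} = mk⇔ (const refl) (const tt)
T-isS {I} = mk⇔ (λ ()) (λ ())

T-isI : ∀ {x} → T (isI x) ⇔ x ≡ I
T-isI {C} = mk⇔ (λ ()) (λ ())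
T-isI {S} = mk⇔ (λ ()) (λ ())
T-isI {I} = mk⇔ (const refl) (const tt)

C∉S : ∀ x → T (isC x) → ¬ T (isS x)
C∉S C _ ()

C∉I : ∀ x → T (isC x) → ¬ T (isI x)
C∉I C _ ()

S∉I : ∀ x → T (isS x) → ¬ T (isI x)
S∉I S _ ()

module PseudoSplit (G : Graph) (part : Fin (n G) → Part) (pseudo-split : IsImperfectPseudoSplit G part) where

  private
    V = Fin (n G)
    variable u v w : V

  inC inS inI : V → Bool
  inC v = isC (part v)
  inS v = isS (part v)
  inI v = isI (part v)

  c i : ℕ
  c = count inC
  i = count inI

  ∈C : part v ≡ C → T (inC v)
  ∈C = Equivalence.from T-isC
  ∈S : part v ≡ S → T (inS v)
  ∈S = Equivalence.from T-isS
  ∈I : part v ≡ I → T (inI v)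
  ∈I = Equivalence.from T-isI

  ∈C⁻ : T (inC v) → part v ≡ C
  ∈C⁻ = Equivalence.to T-isC
  ∈S⁻ : T (inS v) → part v ≡ S
  ∈S⁻ = Equivalence.to T-isS
  ∈I⁻ : T (inI v) → part v ≡ I
  ∈I⁻ = Equivalence.to T-isI

  C-clique : IsClique G inC
  C-clique u v u∈C v∈C = proj₁ pseudo-split u v (∈C⁻ u∈C) (∈C⁻ v∈C)

  I-independent : IsIndependent G inI
  I-independent u v u∈I v∈I = proj₁ (proj₂ pseudo-split) u v (∈I⁻ u∈I) (∈I⁻ v∈I)

  C–S : part u ≡ C → part v ≡ S → Edge G u v
  C–S = proj₁ (proj₂ (proj₂ (proj₂ pseudo-split))) _ _

  I–S : part u ≡ I → part v ≡ S → ¬ Edge G u v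
  I–S = proj₂ (proj₂ (proj₂ (proj₂ pseudo-split))) _ _

  f : Fin 5 → V
  f = proj₁ (proj₁ (proj₂ (proj₂ pseudo-split)))

  f-injective : ∀ j j' → f j ≡ f j' → j ≡ j'
  f-injective = proj₁ (proj₂ (proj₁ (proj₂ (proj₂ pseudo-split))))

  f∈S : ∀ j → part (f j) ≡ S
  f∈S = proj₁ (proj₂ (proj₂ (proj₁ (proj₂ (proj₂ pseudo-split)))))

  f-onto : ∀ v → part v ≡ S → ∃ λ j → f j ≡ v
  f-onto = proj₁ (proj₂ (proj₂ (proj₂ (proj₁ (proj₂ (proj₂ pseudo-split))))))

  f-edge : ∀ j j' → Edge G (f j) (f j') ⇔ C5Adj j j'
  f-edge = proj₂ (proj₂ (proj₂ (proj₂ (proj₁ (proj₂ (proj₂ pseudo-split))))))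

  S⇒∉C : part v ≡ S → ¬ T (inC v)
  S⇒∉C {v} v∈S v∈C = C∉S (part v) v∈C (∈S v∈S)

  S⇒∉I : part v ≡ S → ¬ T (inI v)
  S⇒∉I {v} v∈S = S∉I (part v) (∈S v∈S)

  parts-≢ : ∀ {P Q} → part u ≡ P → part v ≡ Q → P ≢ Q → u ≢ v
  parts-≢ refl refl P≢Q refl = P≢Q refl

  count-S : count inS ≡ 5
  count-S = count-image inS f f-injective (λ j → ∈S (f∈S j))
    (λ v v∈S → f-onto v (∈S⁻ v∈S))

  part-cases : ∀ v → part v ≡ C ⊎ part v ≡ S ⊎ part v ≡ I
  part-cases v with part v
  ... | C = inj₁ refl
  ... | S = inj₂ (inj₁ refl)
  ... | I = inj₂ (inj₂ refl)

  AnticompleteToI CompleteToC : V → Set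
  AnticompleteToI v = ∀ w → part w ≡ I → ¬ Edge G v w
  CompleteToC v = ∀ w → part w ≡ C → Edge G v w

  T⇒Edge : T (adj G u v) → Edge G u v
  T⇒Edge = Equivalence.to Bool.T-≡

  Edge⇒T : Edge G u v → T (adj G u v)
  Edge⇒T = Equivalence.from Bool.T-≡

  degree-C : part v ≡ C → degree G v ≡ c + 4 + count (inI ∩ adj G v)
  degree-C {v} v∈C = begin
    count (adj G v)                        ≡⟨ count-≐ (adj G v) (C∖v ∪ (inS ∪ I∩N)) classify unclassify ⟩
    count (C∖v ∪ (inS ∪ I∩N))              ≡⟨ count-∪ C∖v (inS ∪ I∩N) C∖v∩S∪I∅ ⟩
    count C∖v + count (inS ∪ I∩N)          ≡⟨ cong (count C∖v +_) (count-∪ inS I∩N S∩I∅) ⟩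
    count C∖v + (count inS + count I∩N)    ≡⟨ cong (λ x → count C∖v + (x + count I∩N)) count-S ⟩
    count C∖v + suc (4 + count I∩N)        ≡⟨ ℕ.+-suc (count C∖v) (4 + count I∩N) ⟩
    suc (count C∖v + (4 + count I∩N))      ≡⟨ cong suc (sym (ℕ.+-assoc (count C∖v) 4 (count I∩N))) ⟩
    suc (count C∖v) + 4 + count I∩N        ≡⟨ cong (λ x → x + 4 + count I∩N) (sym (count-remove inC (∈C v∈C))) ⟩
    c + 4 + count I∩N                      ∎
    where
    open ≡-Reasoning
    C∖v I∩N : V → Bool
    C∖v = inC ∩ ∁ ⁅ v ⁆
    I∩N = inI ∩ adj G v
    classify : adj G v ⊆ (C∖v ∪ (inS ∪ I∩N))
    classify w vw with part-cases w
    ... | inj₁ w∈ = ∈∪ˡ C∖v (inS ∪ I∩N) (∈∩ inC (∁ ⁅ v ⁆) (∈C w∈) (∈∁ ⁅ v ⁆ {w} λ w∈v →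
                edge⇒≢ G (T⇒Edge vw) (sym (∈⁅⁆⇒≡ v w w∈v))))
    ... | inj₂ (inj₁ w∈) = ∈∪ʳ C∖v (inS ∪ I∩N) (∈∪ˡ inS I∩N (∈S w∈))
    ... | inj₂ (inj₂ w∈) = ∈∪ʳ C∖v (inS ∪ I∩N) (∈∪ʳ inS I∩N (∈∩ inI (adj G v) (∈I w∈) vw))
    unclassify : (C∖v ∪ (inS ∪ I∩N)) ⊆ adj G v
    unclassify w w∈ with ∈∪⁻ C∖v (inS ∪ I∩N) w∈
    ... | inj₁ w∈C∖v with ∈∩⁻ inC (∁ ⁅ v ⁆) {w} w∈C∖v
    ...   | w∈C , w∉v = Edge⇒T (C-clique v w (∈C v∈C) w∈C (≢-sym (∈∁⁅⁆⇒≢ v w w∉v)))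
    unclassify w w∈ | inj₂ w∈S∪I with ∈∪⁻ inS I∩N w∈S∪I
    ... | inj₁ w∈S = Edge⇒T (C–S v∈C (∈S⁻ w∈S))
    ... | inj₂ w∈I∩N = proj₂ (∈∩⁻ inI (adj G v) w∈I∩N)
    C∖v∩S∪I∅ : Disjoint C∖v (inS ∪ I∩N)
    C∖v∩S∪I∅ w w∈C∖v w∈S∪I = [ C∉S (part w) w∈C , C∉I (part w) w∈C ∘ proj₁ ∘ ∈∩⁻ inI (adj G v) ]′
                                 (∈∪⁻ inS I∩N w∈S∪I)
      where
      w∈C = proj₁ (∈∩⁻ inC (∁ ⁅ v ⁆) {w} w∈C∖v)
    S∩I∅ : Disjoint inS I∩N
    S∩I∅ w w∈S = S∉I (part w) w∈S ∘ proj₁ ∘ ∈∩⁻ inI (adj G v)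

  degree-S : part v ≡ S → degree G v ≡ c + 2
  degree-S {v} v∈S with f-onto v v∈S
  ... | j , refl = trans (count-≐ (adj G (f j)) (inC ∪ (⁅ j⁺ ⁆ ∪ ⁅ j⁻ ⁆)) classify unclassify)
    (count-∪⁅⁆∪⁅⁆ inC (S⇒∉C (f∈S (succ5 j))) (S⇒∉C (f∈S (pred5 j))) (succ5≢pred5 j ∘ f-injective _ _))
    where
    j⁺ j⁻ : V
    j⁺ = f (succ5 j)
    j⁻ = f (pred5 j)
    classify : adj G (f j) ⊆ (inC ∪ (⁅ j⁺ ⁆ ∪ ⁅ j⁻ ⁆))
    classify w fj–w with part-cases w
    ... | inj₁ w∈C = ∈∪ˡ inC (⁅ j⁺ ⁆ ∪ ⁅ j⁻ ⁆) (∈C w∈C)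
    ... | inj₂ (inj₂ w∈I) = ⊥-elim (I–S w∈I v∈S (edge-sym G (T⇒Edge fj–w)))
    ... | inj₂ (inj₁ w∈S) with f-onto w w∈S
    ...   | j' , refl with Equivalence.to C5Adj⇔neighbour (Equivalence.to (f-edge j j') (T⇒Edge fj–w))
    ...     | inj₁ refl = ∈∪ʳ inC (⁅ j⁺ ⁆ ∪ ⁅ j⁻ ⁆) (∈∪ˡ ⁅ j⁺ ⁆ ⁅ j⁻ ⁆ {j⁺} (x∈⁅x⁆ j⁺))
    ...     | inj₂ refl = ∈∪ʳ inC (⁅ j⁺ ⁆ ∪ ⁅ j⁻ ⁆) (∈∪ʳ ⁅ j⁺ ⁆ ⁅ j⁻ ⁆ {j⁻} (x∈⁅x⁆ j⁻))
    unclassify : (inC ∪ (⁅ j⁺ ⁆ ∪ ⁅ j⁻ ⁆)) ⊆ adj G (f j)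
    unclassify w w∈ with ∈∪⁻ inC (⁅ j⁺ ⁆ ∪ ⁅ j⁻ ⁆) w∈
    ... | inj₁ w∈C = Edge⇒T (edge-sym G (C–S (∈C⁻ w∈C) v∈S))
    ... | inj₂ w∈N = ⁅⁆∪⁅⁆-all {P = T ∘ adj G (f j)} j⁺ j⁻
      (Edge⇒T (Equivalence.from (f-edge j (succ5 j)) (C5Adj-succ5 j)))
      (Edge⇒T (Equivalence.from (f-edge j (pred5 j)) (Equivalence.from C5Adj⇔neighbour (inj₂ refl))))
      w w∈N

  neighbours-of-I : part v ≡ I → adj G v ⊆ inC
  neighbours-of-I {v} v∈I w vw with part-cases w
  ... | inj₁ w∈C = ∈C w∈C
  ... | inj₂ (inj₁ w∈S) = ⊥-elim (I–S v∈I w∈S (T⇒Edge vw))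
  ... | inj₂ (inj₂ w∈I) = ⊥-elim (I-independent v w (∈I v∈I) (∈I w∈I) (T⇒Edge vw))

  degree-I-≤ : part v ≡ I → degree G v ≤ c
  degree-I-≤ {v} v∈I = count-mono (adj G v) inC (neighbours-of-I v∈I)

  degree≡c+4⇔ : degree G v ≡ c + 4 ⇔ (part v ≡ C × AnticompleteToI v)
  degree≡c+4⇔ {v} = mk⇔ to from
    where
    to : degree G v ≡ c + 4 → part v ≡ C × AnticompleteToI v
    to deg with part-cases v
    ... | inj₁ v∈C = v∈C , λ w w∈I vw →
      count≡0⇒∉ (inI ∩ adj G v) no-I-neighbour (∈∩ inI (adj G v) (∈I w∈I) (Edge⇒T vw))
      where
      no-I-neighbour : count (inI ∩ adj G v) ≡ 0
      no-I-neighbour = ℕ.+-cancelˡ-≡ (c + 4) _ 0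
        (trans (sym (degree-C v∈C)) (trans deg (sym (ℕ.+-identityʳ (c + 4)))))
    ... | inj₂ (inj₁ v∈S) = case ℕ.+-cancelˡ-≡ c 2 4 (trans (sym (degree-S v∈S)) deg) of λ ()
    ... | inj₂ (inj₂ v∈I) = ⊥-elim (ℕ.m+1+n≰m c (subst (_≤ c) deg (degree-I-≤ v∈I)))
    from : part v ≡ C × AnticompleteToI v → degree G v ≡ c + 4
    from (v∈C , anticomplete) =
      trans (degree-C v∈C) (trans (cong (c + 4 +_) (count-empty _ no-I-neighbour)) (ℕ.+-identityʳ (c + 4)))
      where
      no-I-neighbour : ∀ w → ¬ T ((inI ∩ adj G v) w)
      no-I-neighbour w w∈I∩N with ∈∩⁻ inI (adj G v) w∈I∩N
      ... | w∈I , vw = anticomplete w (∈I⁻ w∈I) (T⇒Edge vw)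

  degree≡c⇔ : degree G v ≡ c ⇔ (part v ≡ I × CompleteToC v)
  degree≡c⇔ {v} = mk⇔ to from
    where
    to : degree G v ≡ c → part v ≡ I × CompleteToC v
    to deg with part-cases v
    ... | inj₁ v∈C =
      ⊥-elim (ℕ.m+1+n≰m c (subst (c + 4 ≤_) (trans (sym (degree-C v∈C)) deg) (ℕ.m≤m+n (c + 4) _)))
    ... | inj₂ (inj₁ v∈S) = ⊥-elim (ℕ.m+1+n≰m c (ℕ.≤-reflexive (trans (sym (degree-S v∈S)) deg)))
    ... | inj₂ (inj₂ v∈I) = v∈I , complete
      where
      complete : CompleteToC v
      complete w w∈C with edge? G v w
      ... | yes vw = vw
      ... | no ¬vw = ⊥-elim (ℕ.<⇒≢ (count-< (adj G v) inC (neighbours-of-I v∈I) (∈C w∈C)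
                                        (¬vw ∘ T⇒Edge)) deg)
    from : part v ≡ I × CompleteToC v → degree G v ≡ c
    from (v∈I , complete) = count-≐ (adj G v) inC (neighbours-of-I v∈I)
      (λ w w∈C → Edge⇒T (complete w (∈C⁻ w∈C)))

  hasDegree : ℕ → V → Bool
  hasDegree d v = degree G v ≡ᵇ d

  T-hasDegree : ∀ {d} → T (hasDegree d v) ⇔ degree G v ≡ d
  T-hasDegree {v} {d} = mk⇔ (ℕ.≡ᵇ⇒≡ (degree G v) d) (ℕ.≡⇒≡ᵇ (degree G v) d)

  anticompleteC completeI : V → Bool
  anticompleteC = hasDegree (c + 4)
  completeI = hasDegree c

  anticompleteC⇔ : T (anticompleteC v) ⇔ (part v ≡ C × AnticompleteToI v)
  anticompleteC⇔ = ⇔.trans T-hasDegree degree≡c+4⇔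

  completeI⇔ : T (completeI v) ⇔ (part v ≡ I × CompleteToC v)
  completeI⇔ = ⇔.trans T-hasDegree degree≡c⇔

  Bounds-k>i Bounds-s>c : ℕ → ℕ → Set
  Bounds-k>i s k = i + 1 ≤ k × c + 2 ≤ s + numDeg G (c + 4)
  Bounds-s>c s k = c + 1 ≤ s × i + 2 ≤ k + numDeg G c

  c-split : c ≡ numDeg G (c + 4) + count (inC ∩ ∁ anticompleteC)
  c-split = count-split-⊆ inC anticompleteC λ v → ∈C ∘ proj₁ ∘ Equivalence.to anticompleteC⇔

  i-split : i ≡ numDeg G c + count (inI ∩ ∁ completeI)
  i-split = count-split-⊆ inI completeI λ v → ∈I ∘ proj₁ ∘ Equivalence.to completeI⇔

  private
    -- A: each vertex of C with a neighbour in I as its own part, and f 0, f 1, f 2 with parts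
    -- {f 1}, {f 0, f 2}.  B: one clique made of the other vertices of C and f 3, f 4, and each
    -- vertex of I as its own clique.
    module Polar-k>i where

      σ : Fin 5 → Bool
      σ = lookup (true ∷ true ∷ true ∷ false ∷ false ∷ [])

      ℓ : Fin 5 → ℕ
      ℓ = lookup (0 ∷ 1 ∷ 0 ∷ 0 ∷ 0 ∷ [])

      ℓ≤1 : ∀ j → ℓ j ≤ 1
      ℓ≤1 = from-yes (all? λ j → ℓ j ℕ.≤? 1)

      σ-parts : PartsOnC5 σ ℓ
      σ-parts = from-yes (partsOnC5? σ ℓ)

      ∁σ-clique : CliquesOnC5 (∁ σ) (const 0)
      ∁σ-clique = from-yes (cliquesOnC5? (∁ σ) (const 0))

      C' : V → Bool
      C' = inC ∩ ∁ anticompleteC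

      data A (v : V) : Set where
        C-with-I-neighbour : T (C' v) → A v
        S-at : ∀ j → f j ≡ v → T (σ j) → A v

      data B (v : V) : Set where
        C-without-I-neighbour : T (anticompleteC v) → B v
        I-vertex : T (inI v) → B v
        S-at : ∀ j → f j ≡ v → T (∁ σ j) → B v

      side : ∀ v → A v ⊎ B v
      side v with part-cases v
      ... | inj₁ v∈C =
        [ inj₂ ∘ C-without-I-neighbour , inj₁ ∘ C-with-I-neighbour ∘ ∈∩ inC (∁ anticompleteC) (∈C v∈C) ]′
          (T-dichotomy (anticompleteC v))
      ... | inj₂ (inj₂ v∈I) = inj₂ (I-vertex (∈I v∈I))
      ... | inj₂ (inj₁ v∈S) with f-onto v v∈S
      ...   | j , fj≡v = [ inj₁ ∘ S-at j fj≡v , inj₂ ∘ S-at j fj≡v ]′ (T-dichotomy (σ j))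

      L : A v → ℕ
      L {v} (C-with-I-neighbour v∈C') = 2 + rank C' v v∈C'
      L (S-at j _ _) = ℓ j

      K : B v → ℕ
      K (C-without-I-neighbour _) = 0
      K {v} (I-vertex v∈I) = 1 + rank inI v v∈I
      K (S-at _ _ _) = 0

      C'⇒C : T (C' v) → part v ≡ C
      C'⇒C {v} = ∈C⁻ ∘ proj₁ ∘ ∈∩⁻ inC (∁ anticompleteC) {v}

      parts : (a : A u) (b : A v) → u ≢ v → Edge G u v ⇔ (L a ≢ L b)
      parts (C-with-I-neighbour u∈C') (C-with-I-neighbour v∈C') u≢v =
        edge⇔ G (C-clique _ _ (∈C (C'⇒C u∈C')) (∈C (C'⇒C v∈C')) u≢v)
                (u≢v ∘ rank-injective C' u∈C' v∈C' ∘ ℕ.+-cancelˡ-≡ 2 _ _)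
      parts (C-with-I-neighbour u∈C') (S-at j refl _) _ =
        edge⇔ G (C–S (C'⇒C u∈C') (f∈S j)) (2+n≢≤1 _ (ℓ≤1 j))
      parts (S-at j refl _) (C-with-I-neighbour v∈C') _ =
        edge⇔ G (edge-sym G (C–S (C'⇒C v∈C') (f∈S j))) (2+n≢≤1 _ (ℓ≤1 j) ∘ sym)
      parts (S-at j refl j∈σ) (S-at j' refl j'∈σ) fj≢fj' =
        ⇔.trans (f-edge j j') (σ-parts j j' j∈σ j'∈σ (fj≢fj' ∘ cong f))

      cliques : (a : B u) (b : B v) → u ≢ v → Edge G u v ⇔ (K a ≡ K b)
      cliques (C-without-I-neighbour u∈) (C-without-I-neighbour v∈) u≢v =
        edge⇔ G (C-clique _ _ (∈C (proj₁ (Equivalence.to anticompleteC⇔ u∈)))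
                               (∈C (proj₁ (Equivalence.to anticompleteC⇔ v∈))) u≢v) refl
      cliques (C-without-I-neighbour u∈) (I-vertex v∈I) _ =
        nonEdge⇔ G (proj₂ (Equivalence.to anticompleteC⇔ u∈) _ (∈I⁻ v∈I)) λ ()
      cliques (I-vertex u∈I) (C-without-I-neighbour v∈) _ =
        nonEdge⇔ G (proj₂ (Equivalence.to anticompleteC⇔ v∈) _ (∈I⁻ u∈I) ∘ edge-sym G) λ ()
      cliques (C-without-I-neighbour u∈) (S-at j refl _) _ =
        edge⇔ G (C–S (proj₁ (Equivalence.to anticompleteC⇔ u∈)) (f∈S j)) refl
      cliques (S-at j refl _) (C-without-I-neighbour v∈) _ =
        edge⇔ G (edge-sym G (C–S (proj₁ (Equivalence.to anticompleteC⇔ v∈)) (f∈S j))) refl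
      cliques (I-vertex u∈I) (I-vertex v∈I) u≢v =
        nonEdge⇔ G (I-independent _ _ u∈I v∈I) (u≢v ∘ rank-injective inI u∈I v∈I ∘ ℕ.suc-injective)
      cliques (I-vertex u∈I) (S-at j refl _) _ =
        nonEdge⇔ G (I–S (∈I⁻ u∈I) (f∈S j)) λ ()
      cliques (S-at j refl _) (I-vertex v∈I) _ =
        nonEdge⇔ G (I–S (∈I⁻ v∈I) (f∈S j) ∘ edge-sym G) λ ()
      cliques (S-at j refl j∉σ) (S-at j' refl j'∉σ) fj≢fj' =
        ⇔.trans (f-edge j j') (∁σ-clique j j' j∉σ j'∉σ (fj≢fj' ∘ cong f))

      polar : ∀ {s k} → Bounds-k>i s k → IsPolar G s k
      polar {s} {k} (k-bound , s-bound) = polar-from-sides G side L K 0<s 0<k L<s K<k parts cliques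
        where
        C'+2≤s : count C' + 2 ≤ s
        C'+2≤s = cancel-surplus (numDeg G (c + 4)) (count C') s
          (subst (λ x → x + 2 ≤ s + numDeg G (c + 4)) c-split s-bound)
        2≤s : 2 ≤ s
        2≤s = ℕ.m+n≤o⇒n≤o (count C') C'+2≤s
        0<s : 0 < s
        0<s = ℕ.≤-trans (s≤s z≤n) 2≤s
        0<k : 0 < k
        0<k = ℕ.m+n≤o⇒n≤o i k-bound
        L<s : (a : A v) → L a < s
        L<s {v} (C-with-I-neighbour v∈C') = offset-< (rank<count C' v v∈C') C'+2≤s
        L<s (S-at j _ _) = ℕ.≤-trans (s≤s (ℓ≤1 j)) 2≤s
        K<k : (b : B v) → K b < k
        K<k (C-without-I-neighbour _) = 0<k
        K<k {v} (I-vertex v∈I) = offset-< (rank<count inI v v∈I) k-bound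
        K<k (S-at _ _ _) = 0<k

    -- A: each vertex of C as its own part, and one part made of f 0, f 2 and the vertices of I
    -- complete to C.  B: the cliques {f 1}, {f 3, f 4}, and each other vertex of I as its own clique.
    module Polar-s>c where

      σ : Fin 5 → Bool
      σ = lookup (true ∷ false ∷ true ∷ false ∷ false ∷ [])

      ℓ : Fin 5 → ℕ
      ℓ = lookup (0 ∷ 0 ∷ 0 ∷ 1 ∷ 1 ∷ [])

      ℓ≤1 : ∀ j → ℓ j ≤ 1
      ℓ≤1 = from-yes (all? λ j → ℓ j ℕ.≤? 1)

      σ-part : PartsOnC5 σ (const 0)
      σ-part = from-yes (partsOnC5? σ (const 0))

      ∁σ-cliques : CliquesOnC5 (∁ σ) ℓ
      ∁σ-cliques = from-yes (cliquesOnC5? (∁ σ) ℓ)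

      I' : V → Bool
      I' = inI ∩ ∁ completeI

      data A (v : V) : Set where
        C-vertex : T (inC v) → A v
        I-complete-to-C : T (completeI v) → A v
        S-at : ∀ j → f j ≡ v → T (σ j) → A v

      data B (v : V) : Set where
        I-vertex : T (I' v) → B v
        S-at : ∀ j → f j ≡ v → T (∁ σ j) → B v

      side : ∀ v → A v ⊎ B v
      side v with part-cases v
      ... | inj₁ v∈C = inj₁ (C-vertex (∈C v∈C))
      ... | inj₂ (inj₂ v∈I) =
        [ inj₁ ∘ I-complete-to-C , inj₂ ∘ I-vertex ∘ ∈∩ inI (∁ completeI) (∈I v∈I) ]′
          (T-dichotomy (completeI v))
      ... | inj₂ (inj₁ v∈S) with f-onto v v∈S
      ...   | j , fj≡v = [ inj₁ ∘ S-at j fj≡v , inj₂ ∘ S-at j fj≡v ]′ (T-dichotomy (σ j))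

      L : A v → ℕ
      L {v} (C-vertex v∈C) = 1 + rank inC v v∈C
      L (I-complete-to-C _) = 0
      L (S-at _ _ _) = 0

      K : B v → ℕ
      K {v} (I-vertex v∈I') = 2 + rank I' v v∈I'
      K (S-at j _ _) = ℓ j

      I'⇒I : T (I' v) → T (inI v)
      I'⇒I {v} = proj₁ ∘ ∈∩⁻ inI (∁ completeI) {v}

      parts : (a : A u) (b : A v) → u ≢ v → Edge G u v ⇔ (L a ≢ L b)
      parts (C-vertex u∈C) (C-vertex v∈C) u≢v =
        edge⇔ G (C-clique _ _ u∈C v∈C u≢v) (u≢v ∘ rank-injective inC u∈C v∈C ∘ ℕ.suc-injective)
      parts (C-vertex u∈C) (I-complete-to-C v∈) _ =
        edge⇔ G (edge-sym G (proj₂ (Equivalence.to completeI⇔ v∈) _ (∈C⁻ u∈C))) λ ()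
      parts (I-complete-to-C u∈) (C-vertex v∈C) _ =
        edge⇔ G (proj₂ (Equivalence.to completeI⇔ u∈) _ (∈C⁻ v∈C)) λ ()
      parts (C-vertex u∈C) (S-at j refl _) _ = edge⇔ G (C–S (∈C⁻ u∈C) (f∈S j)) λ ()
      parts (S-at j refl _) (C-vertex v∈C) _ = edge⇔ G (edge-sym G (C–S (∈C⁻ v∈C) (f∈S j))) λ ()
      parts (I-complete-to-C u∈) (I-complete-to-C v∈) _ =
        nonEdge⇔ G (I-independent _ _ (∈I (proj₁ (Equivalence.to completeI⇔ u∈)))
                                      (∈I (proj₁ (Equivalence.to completeI⇔ v∈)))) (λ 0≢0 → 0≢0 refl)
      parts (I-complete-to-C u∈) (S-at j refl _) _ =
        nonEdge⇔ G (I–S (proj₁ (Equivalence.to completeI⇔ u∈)) (f∈S j)) (λ 0≢0 → 0≢0 refl)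
      parts (S-at j refl _) (I-complete-to-C v∈) _ =
        nonEdge⇔ G (I–S (proj₁ (Equivalence.to completeI⇔ v∈)) (f∈S j) ∘ edge-sym G) (λ 0≢0 → 0≢0 refl)
      parts (S-at j refl j∈σ) (S-at j' refl j'∈σ) fj≢fj' =
        ⇔.trans (f-edge j j') (σ-part j j' j∈σ j'∈σ (fj≢fj' ∘ cong f))

      cliques : (a : B u) (b : B v) → u ≢ v → Edge G u v ⇔ (K a ≡ K b)
      cliques (I-vertex u∈I') (I-vertex v∈I') u≢v =
        nonEdge⇔ G (I-independent _ _ (I'⇒I u∈I') (I'⇒I v∈I'))
                   (u≢v ∘ rank-injective I' u∈I' v∈I' ∘ ℕ.+-cancelˡ-≡ 2 _ _)
      cliques (I-vertex u∈I') (S-at j refl _) _ =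
        nonEdge⇔ G (I–S (∈I⁻ (I'⇒I u∈I')) (f∈S j)) (2+n≢≤1 _ (ℓ≤1 j))
      cliques (S-at j refl _) (I-vertex v∈I') _ =
        nonEdge⇔ G (I–S (∈I⁻ (I'⇒I v∈I')) (f∈S j) ∘ edge-sym G) (2+n≢≤1 _ (ℓ≤1 j) ∘ sym)
      cliques (S-at j refl j∉σ) (S-at j' refl j'∉σ) fj≢fj' =
        ⇔.trans (f-edge j j') (∁σ-cliques j j' j∉σ j'∉σ (fj≢fj' ∘ cong f))

      polar : ∀ {s k} → Bounds-s>c s k → IsPolar G s k
      polar {s} {k} (s-bound , k-bound) = polar-from-sides G side L K 0<s 0<k L<s K<k parts cliques
        where
        I'+2≤k : count I' + 2 ≤ k
        I'+2≤k = cancel-surplus (numDeg G c) (count I') k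
          (subst (λ x → x + 2 ≤ k + numDeg G c) i-split k-bound)
        2≤k : 2 ≤ k
        2≤k = ℕ.m+n≤o⇒n≤o (count I') I'+2≤k
        0<s : 0 < s
        0<s = ℕ.m+n≤o⇒n≤o c s-bound
        0<k : 0 < k
        0<k = ℕ.≤-trans (s≤s z≤n) 2≤k
        L<s : (a : A v) → L a < s
        L<s {v} (C-vertex v∈C) = offset-< (rank<count inC v v∈C) s-bound
        L<s (I-complete-to-C _) = 0<s
        L<s (S-at _ _ _) = 0<s
        K<k : (b : B v) → K b < k
        K<k {v} (I-vertex v∈I') = offset-< (rank<count I' v v∈I') I'+2≤k
        K<k (S-at j _ _) = ℕ.≤-trans (s≤s (ℓ≤1 j)) 2≤k

  module _ {s k} (inA : V → Bool) (multipartite : CompleteMultipartiteAtMost G inA s)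
           (cliques : DisjointCliquesAtMost G (λ v → not (inA v)) k) where

    open PolarPartition G inA multipartite cliques

    S-edge-in-A⇒bounds : ∀ {x₀ x₁ y} → part x₀ ≡ S → part x₁ ≡ S → part y ≡ S →
      InA x₀ → InA x₁ → InB y → Edge G x₀ x₁ → Bounds-k>i s k
    S-edge-in-A⇒bounds {x₀} {x₁} {y} x₀∈S x₁∈S y∈S x₀∈A x₁∈A y∈B x₀x₁ = k-bound , s-bound
      where
      I⊆B : ∀ z → part z ≡ I → InB z
      I⊆B z z∈I with A-or-B z
      ... | inj₂ z∈B = z∈B
      ... | inj₁ z∈A = ⊥-elim (no-induced-co-P₃-in-A x₀∈A z∈A x₁∈A
        (parts-≢ x₀∈S z∈I λ ()) (parts-≢ z∈I x₁∈S λ ()) (I–S z∈I x₀∈S ∘ edge-sym G) (I–S z∈I x₁∈S) x₀x₁)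

      k-bound : i + 1 ≤ k
      k-bound = subst (_≤ k) (count-∪⁅⁆ inI (S⇒∉I y∈S))
        (independent-in-B-≤ (inI ∪ ⁅ y ⁆) I∪y⊆B
          (independent-∪ G I-independent (⁅⁆-independent G y) I≁y))
        where
        I∪y⊆B : ∀ w → T ((inI ∪ ⁅ y ⁆) w) → InB w
        I∪y⊆B w w∈ = [ I⊆B w ∘ ∈I⁻ , ⁅⁆-all {P = InB} y y∈B w ]′ (∈∪⁻ inI ⁅ y ⁆ w∈)
        I≁y : ∀ u v → T (inI u) → T (⁅ y ⁆ v) → ¬ Edge G u v
        I≁y u v u∈I v∈y = I–S (∈I⁻ u∈I) (⁅⁆-all y y∈S v v∈y)

      C∩B⊆anticompleteC : (inC ∩ ∁ inA) ⊆ anticompleteC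
      C∩B⊆anticompleteC v v∈ with ∈∩⁻ inC (∁ inA) {v} v∈
      ... | v∈C , v∈B = Equivalence.from anticompleteC⇔ (∈C⁻ v∈C , no-I-neighbour)
        where
        no-I-neighbour : AnticompleteToI v
        no-I-neighbour z z∈I vz = no-induced-P₃-in-B (I⊆B z z∈I) v∈B y∈B (parts-≢ z∈I y∈S λ ())
          (edge-sym G vz) (C–S (∈C⁻ v∈C) y∈S) (I–S z∈I y∈S)

      s-bound : c + 2 ≤ s + numDeg G (c + 4)
      s-bound = subst (λ x → x + 2 ≤ s + numDeg G (c + 4)) (sym (count-split inC inA))
        (surplus-+ C∩A+2≤s (count-mono (inC ∩ ∁ inA) anticompleteC C∩B⊆anticompleteC))
        where
        pair : V → Bool
        pair = ⁅ x₀ ⁆ ∪ ⁅ x₁ ⁆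
        pair-is-S : ∀ w → T (pair w) → part w ≡ S
        pair-is-S = ⁅⁆∪⁅⁆-all x₀ x₁ x₀∈S x₁∈S
        S⇒∉C∩A : part w ≡ S → ¬ T ((inC ∩ inA) w)
        S⇒∉C∩A {w} w∈S = S⇒∉C w∈S ∘ proj₁ ∘ ∈∩⁻ inC inA {w}
        C∩A∪pair⊆A : ∀ w → T (((inC ∩ inA) ∪ pair) w) → InA w
        C∩A∪pair⊆A w w∈ = [ proj₂ ∘ ∈∩⁻ inC inA {w} , ⁅⁆∪⁅⁆-all {P = InA} x₀ x₁ x₀∈A x₁∈A w ]′
                             (∈∪⁻ (inC ∩ inA) pair w∈)
        C∩A∪pair-clique : IsClique G ((inC ∩ inA) ∪ pair)
        C∩A∪pair-clique =
          clique-∪ G (clique-⊆ G (λ w → proj₁ ∘ ∈∩⁻ inC inA {w}) C-clique) (edge-clique G x₀x₁)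
          λ u v u∈ v∈pair → C–S (∈C⁻ (proj₁ (∈∩⁻ inC inA {u} u∈))) (pair-is-S v v∈pair)
        C∩A+2≤s : count (inC ∩ inA) + 2 ≤ s
        C∩A+2≤s = subst (_≤ s) (count-∪⁅⁆∪⁅⁆ (inC ∩ inA) (S⇒∉C∩A x₀∈S) (S⇒∉C∩A x₁∈S) (edge⇒≢ G x₀x₁))
          (clique-in-A-≤ ((inC ∩ inA) ∪ pair) C∩A∪pair⊆A C∩A∪pair-clique)

    S-nonEdge-in-B⇒bounds : ∀ {x y₁ y₂} → part x ≡ S → part y₁ ≡ S → part y₂ ≡ S →
      InA x → InB y₁ → InB y₂ → y₁ ≢ y₂ → ¬ Edge G y₁ y₂ → Bounds-s>c s k
    S-nonEdge-in-B⇒bounds {x} {y₁} {y₂} x∈S y₁∈S y₂∈S x∈A y₁∈B y₂∈B y₁≢y₂ ¬y₁y₂ = s-bound , k-bound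
      where
      C⊆A : ∀ w → part w ≡ C → InA w
      C⊆A w w∈C with A-or-B w
      ... | inj₁ w∈A = w∈A
      ... | inj₂ w∈B = ⊥-elim (no-induced-P₃-in-B y₁∈B w∈B y₂∈B y₁≢y₂
                                 (edge-sym G (C–S w∈C y₁∈S)) (C–S w∈C y₂∈S) ¬y₁y₂)

      s-bound : c + 1 ≤ s
      s-bound = subst (_≤ s) (count-∪⁅⁆ inC (S⇒∉C x∈S))
        (clique-in-A-≤ (inC ∪ ⁅ x ⁆) C∪x⊆A (clique-∪ G C-clique (⁅⁆-clique G x) C–x))
        where
        C∪x⊆A : ∀ w → T ((inC ∪ ⁅ x ⁆) w) → InA w
        C∪x⊆A w w∈ = [ C⊆A w ∘ ∈C⁻ , ⁅⁆-all {P = InA} x x∈A w ]′ (∈∪⁻ inC ⁅ x ⁆ w∈)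
        C–x : ∀ u v → T (inC u) → T (⁅ x ⁆ v) → Edge G u v
        C–x u v u∈C v∈x = C–S (∈C⁻ u∈C) (⁅⁆-all x x∈S v v∈x)

      I∩A⊆completeI : (inI ∩ inA) ⊆ completeI
      I∩A⊆completeI v v∈ with ∈∩⁻ inI inA {v} v∈
      ... | v∈I , v∈A = Equivalence.from completeI⇔ (∈I⁻ v∈I , complete)
        where
        complete : CompleteToC v
        complete w w∈C with edge? G v w
        ... | yes vw = vw
        ... | no ¬vw = ⊥-elim (no-induced-co-P₃-in-A (C⊆A w w∈C) v∈A x∈A (parts-≢ w∈C (∈I⁻ v∈I) λ ())
          (parts-≢ (∈I⁻ v∈I) x∈S λ ()) (¬vw ∘ edge-sym G) (I–S (∈I⁻ v∈I) x∈S) (C–S w∈C x∈S))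

      k-bound : i + 2 ≤ k + numDeg G c
      k-bound = subst (λ x → x + 2 ≤ k + numDeg G c)
        (trans (ℕ.+-comm (count (inI ∩ ∁ inA)) (count (inI ∩ inA))) (sym (count-split inI inA)))
        (surplus-+ I∩B+2≤k (count-mono (inI ∩ inA) completeI I∩A⊆completeI))
        where
        pair : V → Bool
        pair = ⁅ y₁ ⁆ ∪ ⁅ y₂ ⁆
        pair-is-S : ∀ w → T (pair w) → part w ≡ S
        pair-is-S = ⁅⁆∪⁅⁆-all y₁ y₂ y₁∈S y₂∈S
        S⇒∉I∩B : part w ≡ S → ¬ T ((inI ∩ ∁ inA) w)
        S⇒∉I∩B {w} w∈S = S⇒∉I w∈S ∘ proj₁ ∘ ∈∩⁻ inI (∁ inA) {w}
        I∩B∪pair⊆B : ∀ w → T (((inI ∩ ∁ inA) ∪ pair) w) → InB w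
        I∩B∪pair⊆B w w∈ = [ proj₂ ∘ ∈∩⁻ inI (∁ inA) {w} , ⁅⁆∪⁅⁆-all {P = InB} y₁ y₂ y₁∈B y₂∈B w ]′
                             (∈∪⁻ (inI ∩ ∁ inA) pair w∈)
        I∩B∪pair-independent : IsIndependent G ((inI ∩ ∁ inA) ∪ pair)
        I∩B∪pair-independent =
          independent-∪ G (independent-⊆ G (λ w → proj₁ ∘ ∈∩⁻ inI (∁ inA) {w}) I-independent)
            (nonEdge-independent G ¬y₁y₂)
            λ u v u∈ v∈pair → I–S (∈I⁻ (proj₁ (∈∩⁻ inI (∁ inA) {u} u∈))) (pair-is-S v v∈pair)
        I∩B+2≤k : count (inI ∩ ∁ inA) + 2 ≤ k
        I∩B+2≤k = subst (_≤ k) (count-∪⁅⁆∪⁅⁆ (inI ∩ ∁ inA) (S⇒∉I∩B y₁∈S) (S⇒∉I∩B y₂∈S) y₁≢y₂)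
          (independent-in-B-≤ ((inI ∩ ∁ inA) ∪ pair) I∩B∪pair⊆B I∩B∪pair-independent)

    S⊈A : ¬ (∀ j → InA (f j))
    S⊈A S⊆A = no-induced-co-P₃-in-A (S⊆A (# 0)) (S⊆A (# 2)) (S⊆A (# 4))
      ((λ ()) ∘ f-injective (# 0) (# 2)) ((λ ()) ∘ f-injective (# 2) (# 4))
      ((λ { (inj₁ ()) ; (inj₂ ()) }) ∘ Equivalence.to (f-edge (# 0) (# 2)))
      ((λ { (inj₁ ()) ; (inj₂ ()) }) ∘ Equivalence.to (f-edge (# 2) (# 4)))
      (Equivalence.from (f-edge (# 0) (# 4)) (inj₂ refl))

    S⊈B : ¬ (∀ j → InB (f j))
    S⊈B S⊆B = no-induced-P₃-in-B (S⊆B (# 0)) (S⊆B (# 1)) (S⊆B (# 2)) ((λ ()) ∘ f-injective (# 0) (# 2))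
      (Equivalence.from (f-edge (# 0) (# 1)) (inj₁ refl)) (Equivalence.from (f-edge (# 1) (# 2)) (inj₁ refl))
      ((λ { (inj₁ ()) ; (inj₂ ()) }) ∘ Equivalence.to (f-edge (# 0) (# 2)))

    polar⇒bounds : Bounds-k>i s k ⊎ Bounds-s>c s k
    polar⇒bounds with c5-two-colouring (inA ∘ f)
    ... | inj₁ S⊆A = ⊥-elim (S⊈A S⊆A)
    ... | inj₂ (inj₁ S⊆B) = ⊥-elim (S⊈B S⊆B)
    ... | inj₂ (inj₂ (j , fj∈A , fj⁺∈B)) with A-or-B (f (pred5 j))
    ...   | inj₁ fj⁻∈A = inj₁ (S-edge-in-A⇒bounds (f∈S (pred5 j)) (f∈S j) (f∈S (succ5 j)) fj⁻∈A fj∈A fj⁺∈B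
                                 (Equivalence.from (f-edge (pred5 j) j) (C5Adj-pred5 j)))
    ...   | inj₂ fj⁻∈B = inj₂ (S-nonEdge-in-B⇒bounds (f∈S j) (f∈S (succ5 j)) (f∈S (pred5 j)) fj∈A fj⁺∈B fj⁻∈B
                                 (succ5≢pred5 j ∘ f-injective (succ5 j) (pred5 j))
                                 (succ5-pred5-nonadjacent j ∘ Equivalence.to (f-edge (succ5 j) (pred5 j))))

  bounds⇒polar : ∀ {s k} → Bounds-k>i s k ⊎ Bounds-s>c s k → IsPolar G s k
  bounds⇒polar (inj₁ bounds) = Polar-k>i.polar bounds
  bounds⇒polar (inj₂ bounds) = Polar-s>c.polar bounds

mainTheorem2 : (G : Graph) (part : Fin (n G) → Part) →
    IsImperfectPseudoSplit G part →
    (s k : ℕ) → 1 ≤ s + k →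
    IsPolar G s k ⇔
      ((count (λ v → isI (part v)) + 1 ≤ k ×
        count (λ v → isC (part v)) + 2 ≤ s + numDeg G (count (λ v → isC (part v)) + 4))
      ⊎
       (count (λ v → isC (part v)) + 1 ≤ s ×
        count (λ v → isI (part v)) + 2 ≤ k + numDeg G (count (λ v → isC (part v)))))
mainTheorem2 G part pseudo-split s k _ =
  mk⇔ (λ (inA , multipartite , cliques) → polar⇒bounds inA multipartite cliques) bounds⇒polar
  where open PseudoSplit G part pseudo-split
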